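{- Let $\alpha$ be a weak composition, $\varphi$ a flag, $\lambda$ the partition rearrangement of $\alpha$ and $\lambda^T$ its transpose. The unique element $T\in\mathrm{SSKT}(\alpha,\varphi)$ with $e_i(T)=0$ for all $i>0$ is the tableau of shape $\alpha$ in which column $c$ is filled with $1,2,\dots,\lambda^T_c$ in increasing order from bottom to top, for each $c$.
   Context: Tableaux are fillings by positive integers of finite sets of boxes (row $r$, column $c\in\mathbb{Z}_{>0}$), rows left-justified, French notation (rows indexed increasing upward); $T_{rc}$ is the entry in row $r$, column $c$; the shape is the weak composition of row lengths. A flag is a weakly increasing $\varphi:\mathbb{Z}_{>0}\to\mathbb{Z}_{>0}$ with $\varphi(m)\ge m$. A key tableau is a tableau with (a) rows weakly decreasing left to right; (b) columns with distinct entries; (c) if boxes $(i,j),(k,j)$ with $i<k$ have $T_{ij}>T_{kj}$, then $(i,j+1)$ is a box and $T_{i,j+1}>T_{kj}$. It is $\varphi$-flagged if $T_{ij}\le\varphi(i)$ for all boxes; $\mathrm{SSKT}(\alpha,\varphi)$ is the set of $\varphi$-flagged key tableaux of shape $\alpha$. For a word $\rho=\rho_1\cdots\rho_k$, $m_i(\rho,j)$ is the number of letters $i+1$ minus the number of letters $i$ in $\rho_j\cdots\rho_k$, and $m_i(\rho)=\max_jm_i(\rho,j)$. $\mathsf{col}(T)$ reads the entries of $T$ down each column, columns from right to left. Raising operator: if $m_i(\mathsf{col}(T))\le0$ then $e_i(T)=0$; otherwise let $q$ be the largest index with $m_i(\mathsf{col}(T),q)=m_i(\mathsf{col}(T))$;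 $e_i(T)$ is obtained by changing to $i$ all entries $i+1$ to the right of $\mathsf{col}(T)_q$ in its row, then changing to $i+1$ all entries $i$ in the same columns as these entries. -}

module Defs where

open import Data.Nat as ℕ using (ℕ; zero; suc; _≤_; _<_; _≤?_; _<?_; _≟_; _⊔_)
open import Data.Nat.Properties using (≤-decTotalOrder)
open import Data.Integer as ℤ using (ℤ; +_; _-_)
open import Data.List using (List; []; _∷_; length; map; reverse; filter; concatMap;
  mapMaybe; downFrom; applyUpTo; foldr)
open import Data.Maybe using (Maybe; just; nothing; _>>=_)
import Data.Maybe as Maybe
open import Data.Product using (_×_; _,_; ∃-syntax; proj₁; proj₂)
open import Data.Bool using (Bool; true; false; if_then_else_; _∧_; not)
open import Relation.Nullary using (¬_; does)
open import Relation.Binary.PropositionalEquality using (_≡_)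
open import Data.List.Sort.InsertionSort.Base ≤-decTotalOrder using (sort)

-- A weak composition α = (α₁,…,αₙ) (entry k of the list is α_{k+1}).
WeakComposition : Set
WeakComposition = List ℕ

-- A tableau: list of rows; row r (1-based, French notation, row 1 at the
-- bottom) is element r-1 of the list, read left to right (column 1 first).
Tableau : Set
Tableau = List (List ℕ)

nth : {A : Set} → List A → ℕ → Maybe A
nth []       _       = nothing
nth (x ∷ xs) zero    = just x
nth (x ∷ xs) (suc n) = nth xs n

at : Tableau → ℕ → ℕ → Maybe ℕ
at T zero    _       = nothing
at T (suc r) zero    = nothing
at T (suc r) (suc c) = nth T r >>= λ row → nth row c

shape : Tableau → WeakComposition
shape T = map length T

-- flag: weakly increasing φ : ℤ>0 → ℤ>0 with φ(m) ≥ m  (φ 0 irrelevant)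
IsFlag : (ℕ → ℕ) → Set
IsFlag φ = (∀ m n → 1 ≤ m → m ≤ n → φ m ≤ φ n) × (∀ m → 1 ≤ m → m ≤ φ m)

record IsKeyTableau (T : Tableau) : Set where
  field
    positive  : ∀ r c x → at T r c ≡ just x → 1 ≤ x
    rowsDecr  : ∀ r c x y → at T r c ≡ just x → at T r (suc c) ≡ just y → y ≤ x
    colsDistinct : ∀ i k c x y → ¬ (i ≡ k) → at T i c ≡ just x → at T k c ≡ just y → ¬ (x ≡ y)
    keyCond   : ∀ i k j x y → i < k → at T i j ≡ just x → at T k j ≡ just y → y < x →
                ∃[ z ] (at T i (suc j) ≡ just z × y < z)

Flagged : (ℕ → ℕ) → Tableau → Set
Flagged φ T = ∀ r c x → at T r c ≡ just x → x ≤ φ r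

SSKT : WeakComposition → (ℕ → ℕ) → Tableau → Set
SSKT α φ T = shape T ≡ α × IsKeyTableau T × Flagged φ T

maxWidth : Tableau → ℕ
maxWidth T = foldr _⊔_ 0 (map length T)

-- boxes of T in the order of col(T): columns right to left, each column
-- read downward (top row to bottom row); entries are (r , c , T_{rc}).
colBoxes : Tableau → List (ℕ × ℕ × ℕ)
colBoxes T =
  concatMap (λ c → mapMaybe (λ r → Maybe.map (λ x → (r , c , x)) (at T r c))
                            (map suc (downFrom (length T))))
            (map suc (downFrom (maxWidth T)))

col : Tableau → List ℕ
col T = map (λ b → proj₂ (proj₂ b)) (colBoxes T)

count : ℕ → List ℕ → ℕ
count a ρ = length (filter (λ x → x ≟ a) ρ)

-- m_i(ρ, j) for the suffix ρ_j ⋯ ρ_k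
mSuffixVal : ℕ → List ℕ → ℤ
mSuffixVal i σ = + count (suc i) σ - + count i σ

mList : ℕ → List ℕ → List ℤ
mList i []       = []
mList i (x ∷ xs) = mSuffixVal i (x ∷ xs) ∷ mList i xs

-- m_i(ρ) = max_j m_i(ρ,j)  (seeded with 0: this only matters for
-- the empty word, and never changes whether m_i(ρ) ≤ 0 nor the index q)
mMax : ℕ → List ℕ → ℤ
mMax i ρ = foldr ℤ._⊔_ (+ 0) (mList i ρ)

-- largest 1-based index q with value v in the list (offset n)
lastIndex : ℤ → List ℤ → ℕ → Maybe ℕ
lastIndex v []       n = nothing
lastIndex v (x ∷ xs) n with lastIndex v xs (suc n)
... | just q  = just q
... | nothing = if does (x ℤ.≟ v) then just (suc n) else nothing

raiseEntry : ℕ → Tableau → ℕ → ℕ → ℕ → ℕ → ℕ → ℕ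
raiseEntry i T r c r' c' x =
  if does (r' ≟ r) ∧ does (c ≤? c') ∧ does (x ≟ suc i) then i
  else if not (does (r' ≟ r)) ∧ does (x ≟ i) ∧ does (c ≤? c') ∧ isIp1 (at T r c')
       then suc i else x
  where
  isIp1 : Maybe ℕ → Bool
  isIp1 (just y) = does (y ≟ suc i)
  isIp1 nothing  = false

mapIdx : {A B : Set} → (ℕ → A → B) → ℕ → List A → List B
mapIdx f n []       = []
mapIdx f n (x ∷ xs) = f n x ∷ mapIdx f (suc n) xs

raiseAt : ℕ → Tableau → ℕ → ℕ → Tableau
raiseAt i T r c =
  mapIdx (λ r' row → mapIdx (λ c' x → raiseEntry i T r c r' c' x) 1 row) 1 T

-- e_i(T); "nothing" represents e_i(T) = 0.
e : ℕ → Tableau → Maybe Tableau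
e i T with (mMax i (col T)) ℤ.≤? (+ 0)
... | Relation.Nullary.yes _ = nothing
... | Relation.Nullary.no  _ =
  lastIndex (mMax i (col T)) (mList i (col T)) 0 >>= λ q →
  nth (colBoxes T) (q ℕ.∸ 1) >>= λ b →
  just (raiseAt i T (proj₁ b) (proj₁ (proj₂ b)))

partitionOf : WeakComposition → List ℕ
partitionOf α = reverse (sort (filter (λ a → 1 ≤? a) α))

transposeAt : List ℕ → ℕ → ℕ
transposeAt λ' c = length (filter (λ p → c ≤? p) λ')

column : Tableau → ℕ → List ℕ
column T c = mapMaybe (λ row → nth row (c ℕ.∸ 1)) T

IsCanonical : WeakComposition → Tableau → Set
IsCanonical α T =
  shape T ≡ α × (∀ c → 1 ≤ c → column T c ≡ applyUpTo suc (transposeAt (partitionOf α) c))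

-- e_i(T) = 0 for every i ≥ 1 says that col(T) is a lattice word: every suffix contains at least as
-- many letters i as letters i + 1.  Read backwards, col(T) lists the columns of T from left to right,
-- each from the bottom up.  Suppose the columns read so far are 1, 2, …, h, and every entry x ≥ 2
-- of the next column is at most its left neighbour, hence occurs in those columns exactly as often
-- as x − 1.  If the next column skipped a value, its lowest entry x above the skip would start a
-- suffix with more letters x than x − 1; so the next column is again 1, 2, …, h′.  Thus every column c
-- of T is 1, …, λᵀ_c, and shape and columns determine T.  Conversely this tableau is a key tableau
-- whose entries in row r are at most r, and each column contributes a lattice factor h, …, 2, 1.

module Submission where

open import Defs
open import Data.Nat using (ℕ; _≤_; zero; suc; pred; _+_; _<_; _≟_; _≤?_; _<?_; z≤n; s≤s; _∸_)
import Data.Nat.Properties as ℕP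
open import Data.Integer as ℤ using (+_)
import Data.Integer.Properties as ℤP
open import Data.List
  using (List; []; _∷_; _++_; [_]; _∷ʳ_; length; map; reverse; filter; mapMaybe;
         applyUpTo; applyDownFrom; downFrom; upTo; take; drop; concatMap)
import Data.List.Properties as LP
open import Data.List.Membership.Propositional using (_∈_)
open import Data.List.Relation.Unary.Any using (here; there)
open import Data.List.Relation.Unary.All as All using (All)
open import Data.List.Relation.Unary.AllPairs using ([]; _∷_)
open import Data.List.Relation.Unary.Unique.Propositional using (Unique)
open import Data.List.Relation.Binary.Permutation.Propositional using (_↭_; ↭-trans)
import Data.List.Relation.Binary.Permutation.Propositional.Properties as ↭P
open import Data.List.Sort.InsertionSort.Properties ℕP.≤-decTotalOrder using (sort-↭)
open import Data.Maybe using (Maybe; just; nothing; _>>=_)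
import Data.Maybe as Maybe
open import Data.Product using (_×_; ∃-syntax; _,_; proj₁; proj₂)
open import Data.Sum using (_⊎_; inj₁; inj₂)
open import Data.Empty using (⊥-elim)
open import Data.Unit using (⊤; tt)
open import Relation.Nullary using (¬_; yes; no)
open import Relation.Binary.PropositionalEquality
  using (_≡_; refl; sym; trans; cong; cong₂; subst; subst₂; _≢_; module ≡-Reasoning)
open import Relation.Binary.Definitions using (tri<; tri≈; tri>)
open import Function using (_∘_)

count-here : ∀ a xs → count a (a ∷ xs) ≡ suc (count a xs)
count-here a xs = cong length (LP.filter-accept (_≟ a) refl)

count-there : ∀ {a x} xs → x ≢ a → count a (x ∷ xs) ≡ count a xs
count-there xs x≢a = cong length (LP.filter-reject (_≟ _) x≢a)

count-++ : ∀ a xs ys → count a (xs ++ ys) ≡ count a xs + count a ys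
count-++ a xs ys =
  trans (cong length (LP.filter-++ (_≟ a) xs ys)) (LP.length-++ (filter (_≟ a) xs))

Lattice : ℕ → List ℕ → Set
Lattice i []       = ⊤
Lattice i (x ∷ xs) = count (suc i) (x ∷ xs) ≤ count i (x ∷ xs) × Lattice i xs

lattice-count : ∀ i xs → Lattice i xs → count (suc i) xs ≤ count i xs
lattice-count i []       _       = z≤n
lattice-count i (x ∷ xs) (p , _) = p

lattice-++⁻ʳ : ∀ i xs {ys} → Lattice i (xs ++ ys) → Lattice i ys
lattice-++⁻ʳ i []       L       = L
lattice-++⁻ʳ i (x ∷ xs) (_ , L) = lattice-++⁻ʳ i xs L

lattice⇒mMax≤0 : ∀ i ρ → Lattice i ρ → mMax i ρ ℤ.≤ + 0
lattice⇒mMax≤0 i []       _       = ℤP.≤-refl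
lattice⇒mMax≤0 i (x ∷ xs) (p , L) =
  ℤP.⊔-lub (ℤP.i≤j⇒i-j≤0 (ℤ.+≤+ p)) (lattice⇒mMax≤0 i xs L)

mMax≤0⇒lattice : ∀ i ρ → mMax i ρ ℤ.≤ + 0 → Lattice i ρ
mMax≤0⇒lattice i []       _ = tt
mMax≤0⇒lattice i (x ∷ xs) p =
  ℤP.drop‿+≤+ (ℤP.i-j≤0⇒i≤j (ℤP.i⊔j≤k⇒i≤k _ _ p)) , mMax≤0⇒lattice i xs (ℤP.i⊔j≤k⇒j≤k _ _ p)

mMax≡0⊎∈mList : ∀ i ρ → mMax i ρ ≡ + 0 ⊎ mMax i ρ ∈ mList i ρ
mMax≡0⊎∈mList i [] = inj₁ refl
mMax≡0⊎∈mList i (x ∷ xs) with ℤP.≤-total (mSuffixVal i (x ∷ xs)) (mMax i xs)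
... | inj₂ tail≤head rewrite ℤP.i≥j⇒i⊔j≡i tail≤head = inj₂ (here refl)
... | inj₁ head≤tail rewrite ℤP.i≤j⇒i⊔j≡j head≤tail with mMax≡0⊎∈mList i xs
...   | inj₁ mMax≡0 = inj₁ mMax≡0
...   | inj₂ mMax∈   = inj₂ (there mMax∈)

lastIndex-complete : ∀ v l n → v ∈ l → lastIndex v l n ≢ nothing
lastIndex-complete v (x ∷ xs) n v∈ with lastIndex v xs (suc n) in found
... | just _  = λ ()
... | nothing with x ℤ.≟ v
...   | yes _   = λ ()
...   | no x≢v with v∈
...     | here v≡x  = ⊥-elim (x≢v (sym v≡x))
...     | there v∈′ = ⊥-elim (lastIndex-complete v xs (suc n) v∈′ found)

lastIndex-index : ∀ v l n {q} → lastIndex v l n ≡ just q → ∃[ k ] (q ≡ suc (n + k) × k < length l)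
lastIndex-index v (x ∷ xs) n eq with lastIndex v xs (suc n) in found
... | just _ with refl ← eq with lastIndex-index v xs (suc n) found
...   | k , refl , k< = suc k , cong suc (sym (ℕP.+-suc n k)) , s≤s k<
lastIndex-index v (x ∷ xs) n eq | nothing with x ℤ.≟ v
... | yes _ with refl ← eq = 0 , cong suc (sym (ℕP.+-identityʳ n)) , s≤s z≤n
lastIndex-index v (x ∷ xs) n () | nothing | no _

nth-defined : ∀ {A : Set} (xs : List A) k → k < length xs → ∃[ b ] (nth xs k ≡ just b)
nth-defined (x ∷ xs) zero    _       = x , refl
nth-defined (x ∷ xs) (suc k) (s≤s k<) = nth-defined xs k k<

bind-just≢nothing : ∀ {A B : Set} {m : Maybe A} {a} {f : A → B} →
                    m ≡ just a → (m >>= λ x → just (f x)) ≢ nothing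
bind-just≢nothing refl ()

length-mList : ∀ i ρ → length (mList i ρ) ≡ length ρ
length-mList i []       = refl
length-mList i (x ∷ xs) = cong suc (length-mList i xs)

length-mList-col : ∀ i T → length (mList i (col T)) ≡ length (colBoxes T)
length-mList-col i T = trans (length-mList i (col T)) (LP.length-map _ (colBoxes T))

lattice⇒e≡nothing : ∀ i T → Lattice i (col T) → e i T ≡ nothing
lattice⇒e≡nothing i T L with mMax i (col T) ℤ.≤? + 0
... | yes _       = refl
... | no mMax≰0 = ⊥-elim (mMax≰0 (lattice⇒mMax≤0 i (col T) L))

-- mMax is seeded with 0, so a positive maximum is attained at some q, and col(T)_q is then a box.
e≡nothing⇒mMax≤0 : ∀ i T → e i T ≡ nothing → mMax i (col T) ℤ.≤ + 0
e≡nothing⇒mMax≤0 i T eq with mMax i (col T) ℤ.≤? + 0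
... | yes mMax≤0 = mMax≤0
... | no mMax≰0 with mMax≡0⊎∈mList i (col T)
...   | inj₁ mMax≡0 = ⊥-elim (mMax≰0 (ℤP.≤-reflexive mMax≡0))
...   | inj₂ mMax∈ with lastIndex (mMax i (col T)) (mList i (col T)) 0 in found
...     | nothing = ⊥-elim (lastIndex-complete _ _ 0 mMax∈ found)
...     | just q with lastIndex-index (mMax i (col T)) (mList i (col T)) 0 found
...       | k , refl , k< with nth-defined (colBoxes T) k (subst (k <_) (length-mList-col i T) k<)
...         | _ , nth≡just = ⊥-elim (bind-just≢nothing nth≡just eq)

e≡nothing⇒lattice : ∀ i T → e i T ≡ nothing → Lattice i (col T)
e≡nothing⇒lattice i T = mMax≤0⇒lattice i (col T) ∘ e≡nothing⇒mMax≤0 i T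

columnWord : (ℕ → List ℕ) → ℕ → List ℕ
columnWord C zero    = []
columnWord C (suc w) = reverse (C (suc w)) ++ columnWord C w

entries-of-boxes : ∀ T c rs →
  map (proj₂ ∘ proj₂) (mapMaybe (λ r → Maybe.map (λ x → (r , c , x)) (at T r c)) rs)
    ≡ mapMaybe (λ r → at T r c) rs
entries-of-boxes T c []       = refl
entries-of-boxes T c (r ∷ rs) with at T r c
... | just x  = cong (x ∷_) (entries-of-boxes T c rs)
... | nothing = entries-of-boxes T c rs

mapMaybe-reverse : ∀ {A B : Set} (f : A → Maybe B) xs → mapMaybe f (reverse xs) ≡ reverse (mapMaybe f xs)
mapMaybe-reverse f [] = refl
mapMaybe-reverse f (x ∷ xs)
  rewrite LP.unfold-reverse x xs | LP.mapMaybe-++ f (reverse xs) [ x ] | mapMaybe-reverse f xs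
  with f x
... | just y  = sym (LP.unfold-reverse y (mapMaybe f xs))
... | nothing = LP.++-identityʳ _

mapMaybe-nth-applyUpTo : ∀ {A B : Set} (f : A → Maybe B) (xs : List A) (g : ℕ → Maybe B) (h : ℕ → ℕ) →
  (∀ r → g (h r) ≡ (nth xs r >>= f)) → mapMaybe g (applyUpTo h (length xs)) ≡ mapMaybe f xs
mapMaybe-nth-applyUpTo f []       g h g∘h≡ = refl
mapMaybe-nth-applyUpTo f (x ∷ xs) g h g∘h≡
  with g (h 0) | g∘h≡ 0 | mapMaybe-nth-applyUpTo f xs g (h ∘ suc) (g∘h≡ ∘ suc)
... | _ | refl | ih with f x
...   | just y  = cong (y ∷_) ih
...   | nothing = ih

mapMaybe-nth-downFrom : ∀ {A B : Set} (f : A → Maybe B) (xs : List A) →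
  mapMaybe (λ r → nth xs r >>= f) (downFrom (length xs)) ≡ reverse (mapMaybe f xs)
mapMaybe-nth-downFrom f xs = begin
  mapMaybe g (downFrom (length xs))
    ≡⟨ cong (mapMaybe g) (sym (LP.reverse-upTo (length xs))) ⟩
  mapMaybe g (reverse (upTo (length xs)))
    ≡⟨ mapMaybe-reverse g (upTo (length xs)) ⟩
  reverse (mapMaybe g (upTo (length xs)))
    ≡⟨ cong reverse (mapMaybe-nth-applyUpTo f xs g (λ r → r) (λ _ → refl)) ⟩
  reverse (mapMaybe f xs) ∎
  where
  open ≡-Reasoning
  g : ℕ → Maybe _
  g r = nth xs r >>= f

boxesOfColumn : Tableau → ℕ → List (ℕ × ℕ × ℕ)
boxesOfColumn T c = mapMaybe (λ r → Maybe.map (λ x → (r , c , x)) (at T r c)) (map suc (downFrom (length T)))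

map-entry-boxesOfColumn : ∀ T c → map (proj₂ ∘ proj₂) (boxesOfColumn T (suc c)) ≡ reverse (column T (suc c))
map-entry-boxesOfColumn T c = begin
  map (proj₂ ∘ proj₂) (boxesOfColumn T (suc c))
    ≡⟨ entries-of-boxes T (suc c) (map suc (downFrom (length T))) ⟩
  mapMaybe (λ r → at T r (suc c)) (map suc (downFrom (length T)))
    ≡⟨ LP.mapMaybe-map (λ r → at T r (suc c)) suc (downFrom (length T)) ⟩
  mapMaybe (λ r → at T (suc r) (suc c)) (downFrom (length T))
    ≡⟨ mapMaybe-nth-downFrom (λ row → nth row c) T ⟩
  reverse (column T (suc c)) ∎
  where open ≡-Reasoning

col≡columnWord : ∀ T → col T ≡ columnWord (column T) (maxWidth T)
col≡columnWord T = go (maxWidth T)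
  where
  go : ∀ w → map (proj₂ ∘ proj₂) (concatMap (boxesOfColumn T) (map suc (downFrom w))) ≡ columnWord (column T) w
  go zero    = refl
  go (suc w) = trans (LP.map-++ (proj₂ ∘ proj₂) (boxesOfColumn T (suc w)) _)
                     (cong₂ _++_ (map-entry-boxesOfColumn T w) (go w))

interval : ℕ → ℕ → List ℕ
interval s zero    = []
interval s (suc n) = suc s ∷ interval (suc s) n

length-interval : ∀ s n → length (interval s n) ≡ n
length-interval s zero    = refl
length-interval s (suc n) = cong suc (length-interval (suc s) n)

applyUpTo≡interval : ∀ n s f → (∀ k → f k ≡ suc (s + k)) → applyUpTo f n ≡ interval s n
applyUpTo≡interval zero    s f f≡ = refl
applyUpTo≡interval (suc n) s f f≡ =
  cong₂ _∷_ (trans (f≡ 0) (cong suc (ℕP.+-identityʳ s)))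
            (applyUpTo≡interval n (suc s) (f ∘ suc) (λ k → trans (f≡ (suc k)) (cong suc (ℕP.+-suc s k))))

reverse-interval : ∀ h → reverse (interval 0 h) ≡ applyDownFrom suc h
reverse-interval h =
  trans (cong reverse (sym (applyUpTo≡interval h 0 suc (λ _ → refl)))) (LP.reverse-applyUpTo suc h)

∈-interval⁻ : ∀ {s n x} → x ∈ interval s n → s < x × x ≤ s + n
∈-interval⁻ {s} {suc n} (here refl) =
  ℕP.n<1+n s , subst (suc s ≤_) (sym (ℕP.+-suc s n)) (s≤s (ℕP.m≤m+n s n))
∈-interval⁻ {s} {suc n} {x} (there x∈) with ∈-interval⁻ x∈
... | s<x , x≤ = ℕP.<-trans (ℕP.n<1+n s) s<x , subst (x ≤_) (sym (ℕP.+-suc s n)) x≤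

∈-interval⁺ : ∀ {s n x} → s < x → x ≤ s + n → x ∈ interval s n
∈-interval⁺ {s} {zero}  {x} s<x x≤ = ⊥-elim (ℕP.<⇒≱ s<x (subst (x ≤_) (ℕP.+-identityʳ s) x≤))
∈-interval⁺ {s} {suc n} {x} s<x x≤ with x ≟ suc s
... | yes refl = here refl
... | no x≢    = there (∈-interval⁺ (ℕP.≤∧≢⇒< s<x (x≢ ∘ sym)) (subst (x ≤_) (ℕP.+-suc s n) x≤))

interval-entry : ∀ s n P x Q → interval s n ≡ P ++ x ∷ Q → x ≡ suc (s + length P)
interval-entry s zero    []      x Q ()
interval-entry s zero    (_ ∷ P) x Q ()
interval-entry s (suc n) []      x Q refl = cong suc (sym (ℕP.+-identityʳ s))
interval-entry s (suc n) (_ ∷ P) x Q eq =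
  trans (interval-entry (suc s) n P x Q (proj₂ (LP.∷-injective eq))) (cong suc (sym (ℕP.+-suc s (length P))))

count-applyDownFrom-absent : ∀ h a → h < a → count a (applyDownFrom suc h) ≡ 0
count-applyDownFrom-absent zero    a _   = refl
count-applyDownFrom-absent (suc h) a h<a =
  trans (count-there (applyDownFrom suc h) (λ h≡a → ℕP.<-irrefl h≡a h<a))
        (count-applyDownFrom-absent h a (ℕP.<-trans (ℕP.n<1+n h) h<a))

count-applyDownFrom-present : ∀ h a → 1 ≤ a → a ≤ h → count a (applyDownFrom suc h) ≡ 1
count-applyDownFrom-present zero    a 1≤a a≤0 = ⊥-elim (ℕP.<⇒≱ 1≤a a≤0)
count-applyDownFrom-present (suc h) a 1≤a a≤ with a ≟ suc h
... | yes refl = trans (count-here (suc h) _) (cong suc (count-applyDownFrom-absent h (suc h) (ℕP.n<1+n h)))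
... | no a≢    = trans (count-there _ (a≢ ∘ sym))
                       (count-applyDownFrom-present h a 1≤a (ℕP.m<1+n⇒m≤n (ℕP.≤∧≢⇒< a≤ a≢)))

count-applyDownFrom-mono : ∀ h {i} → 1 ≤ i → count (suc i) (applyDownFrom suc h) ≤ count i (applyDownFrom suc h)
count-applyDownFrom-mono h {i} 1≤i with suc i ≤? h
... | yes i<h = ℕP.≤-reflexive (trans (count-applyDownFrom-present h (suc i) (s≤s z≤n) i<h)
                                      (sym (count-applyDownFrom-present h i 1≤i (ℕP.<⇒≤ i<h))))
... | no  i≮h rewrite count-applyDownFrom-absent h (suc i) (ℕP.≰⇒> i≮h) = z≤n

lattice-applyDownFrom-++ : ∀ h {i Z} → 1 ≤ i → Lattice i Z → Lattice i (applyDownFrom suc h ++ Z)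
lattice-applyDownFrom-++ zero    1≤i L = L
lattice-applyDownFrom-++ (suc h) {i} {Z} 1≤i L =
  subst₂ _≤_ (sym (count-++ (suc i) (applyDownFrom suc (suc h)) Z))
             (sym (count-++ i (applyDownFrom suc (suc h)) Z))
         (ℕP.+-mono-≤ (count-applyDownFrom-mono (suc h) 1≤i) (lattice-count i Z L))
  , lattice-applyDownFrom-++ h 1≤i L

lattice-columnWord : ∀ C → (∀ c → C (suc c) ≡ interval 0 (length (C (suc c)))) →
                     ∀ w {i} → 1 ≤ i → Lattice i (columnWord C w)
lattice-columnWord C intervals zero    1≤i = tt
lattice-columnWord C intervals (suc w) 1≤i =
  subst (λ D → Lattice _ (reverse D ++ columnWord C w)) (sym (intervals w))
    (subst (λ D → Lattice _ (D ++ columnWord C w)) (sym (reverse-interval (length (C (suc w)))))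
      (lattice-applyDownFrom-++ (length (C (suc w))) 1≤i (lattice-columnWord C intervals w 1≤i)))

lattice-columnWord-≤ : ∀ C {k w i} → k ≤ w → Lattice i (columnWord C w) → Lattice i (columnWord C k)
lattice-columnWord-≤ C k≤w L with ℕP.m≤n⇒m<n∨m≡n k≤w
... | inj₂ refl = L
lattice-columnWord-≤ C {w = suc w} {i} _ L | inj₁ (s≤s k≤w) =
  lattice-columnWord-≤ C k≤w (lattice-++⁻ʳ i (reverse (C (suc w))) L)

-- In a lattice word Z, Tight Z x forces x − 1 and x to occur equally often.
Tight : List ℕ → ℕ → Set
Tight Z x = 2 ≤ x → count (pred x) Z ≤ count x Z

tight-applyDownFrom-++ : ∀ h {Z x} → x ≤ h → Tight Z x → Tight (applyDownFrom suc h ++ Z) x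
tight-applyDownFrom-++ h {Z} {x@(suc (suc m))} x≤h tight 2≤x =
  subst₂ _≤_ (sym (count-++ (suc m) (applyDownFrom suc h) Z)) (sym (count-++ x (applyDownFrom suc h) Z))
    (subst₂ (λ a b → a + count (suc m) Z ≤ b + count x Z)
            (sym (count-applyDownFrom-present h (suc m) (s≤s z≤n) (ℕP.<⇒≤ x≤h)))
            (sym (count-applyDownFrom-present h x (s≤s z≤n) x≤h))
            (s≤s (tight 2≤x)))
tight-applyDownFrom-++ h {x = 1} _ _ (s≤s ())

reverse-∷-++ : ∀ (x : ℕ) D Z → reverse (x ∷ D) ++ Z ≡ reverse D ++ x ∷ Z
reverse-∷-++ x D Z = trans (cong (_++ Z) (LP.unfold-reverse x D)) (LP.++-assoc (reverse D) [ x ] Z)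

-- An entry x above a gap would make the suffix starting at x contain more letters x than x − 1.
no-gap : ∀ j Z x → suc j < x → Tight Z x →
         ¬ Lattice (pred x) (x ∷ applyDownFrom suc j ++ Z)
no-gap j Z x@(suc (suc m)) (s≤s (s≤s j≤m)) tight (lattice , _) =
  ℕP.<-irrefl refl (ℕP.≤-trans (subst₂ _≤_ count-x count-x-1 lattice) (tight (s≤s (s≤s z≤n))))
  where
  count-x : count x (x ∷ applyDownFrom suc j ++ Z) ≡ suc (count x Z)
  count-x = trans (count-here x _) (cong suc (trans (count-++ x (applyDownFrom suc j) Z)
              (cong (_+ count x Z) (count-applyDownFrom-absent j x (s≤s (ℕP.m≤n⇒m≤1+n j≤m))))))
  count-x-1 : count (suc m) (x ∷ applyDownFrom suc j ++ Z) ≡ count (suc m) Z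
  count-x-1 = trans (count-there _ (λ x≡ → ℕP.<-irrefl (sym x≡) (ℕP.n<1+n (suc m))))
                (trans (count-++ (suc m) (applyDownFrom suc j) Z)
                       (cong (_+ count (suc m) Z) (count-applyDownFrom-absent j (suc m) (s≤s j≤m))))

lattice-column-interval : ∀ D j Z → All (j <_) D → Unique D → All (Tight Z) D →
  (∀ i → 1 ≤ i → Lattice i (reverse D ++ applyDownFrom suc j ++ Z)) → D ≡ interval j (length D)
lattice-column-interval []      j Z _ _ _ _ = refl
lattice-column-interval (x ∷ D) j Z (j<x All.∷ j<D) (x≢D ∷ unique) (tightx All.∷ tightD) lattice
  with x ≟ suc j
... | yes refl =
  cong (suc j ∷_) (lattice-column-interval D (suc j) Z
    (All.zipWith (λ (j<y , x≢y) → ℕP.≤∧≢⇒< j<y x≢y) (j<D , x≢D)) unique tightD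
    (λ i 1≤i → subst (Lattice i) (reverse-∷-++ x D _) (lattice i 1≤i)))
... | no x≢ = ⊥-elim (no-gap j Z x j+1<x tightx lattice-from-x)
  where
  j+1<x : suc j < x
  j+1<x = ℕP.≤∧≢⇒< j<x (x≢ ∘ sym)
  lattice-from-x : Lattice (pred x) (x ∷ applyDownFrom suc j ++ Z)
  lattice-from-x = lattice-++⁻ʳ (pred x) (reverse D)
    (subst (Lattice (pred x)) (reverse-∷-++ x D _)
           (lattice (pred x) (ℕP.<⇒≤pred (ℕP.≤-trans (s≤s (s≤s z≤n)) j+1<x))))

next-column-interval : ∀ D Z → All (1 ≤_) D → Unique D → All (Tight Z) D →
  (∀ i → 1 ≤ i → Lattice i (reverse D ++ Z)) →
  D ≡ interval 0 (length D) × All (Tight (reverse D ++ Z)) D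
next-column-interval D Z positive unique tight lattice = D≡interval , All.tabulate tight′
  where
  D≡interval : D ≡ interval 0 (length D)
  D≡interval = lattice-column-interval D 0 Z positive unique tight lattice
  tight′ : ∀ {x} → x ∈ D → Tight (reverse D ++ Z) x
  tight′ {x} x∈D =
    subst (λ E → Tight (reverse E ++ Z) x) (sym D≡interval)
      (subst (λ E → Tight (E ++ Z) x) (sym (reverse-interval (length D)))
        (tight-applyDownFrom-++ (length D) (proj₂ (∈-interval⁻ (subst (x ∈_) D≡interval x∈D)))
                                (All.lookup tight x∈D)))

module _ (C : ℕ → List ℕ) (w : ℕ)
         (positive : ∀ c → All (1 ≤_) (C (suc c)))
         (unique : ∀ c → Unique (C (suc c)))
         (dominated : ∀ c {x} → x ∈ C (suc (suc c)) → ∃[ y ] (y ∈ C (suc c) × x ≤ y))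
         (lattice : ∀ i → 1 ≤ i → Lattice i (columnWord C w)) where

  private
    columns-tight : ∀ k → suc k ≤ w →
      C (suc k) ≡ interval 0 (length (C (suc k))) × All (Tight (columnWord C (suc k))) (C (suc k))
    columns-tight zero 1≤w =
      next-column-interval (C 1) [] (positive 0) (unique 0) (All.tabulate λ _ _ → z≤n)
        (λ i 1≤i → lattice-columnWord-≤ C 1≤w (lattice i 1≤i))
    columns-tight (suc k) k+2≤w with columns-tight k (ℕP.<⇒≤ k+2≤w)
    ... | C≡interval , tightC =
      next-column-interval (C (suc (suc k))) (columnWord C (suc k)) (positive (suc k)) (unique (suc k))
        (All.tabulate tight) (λ i 1≤i → lattice-columnWord-≤ C k+2≤w (lattice i 1≤i))
      where
      -- x is at most its left neighbour, an entry of the interval C (suc k), so x ∈ C (suc k).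
      tight : ∀ {x} → x ∈ C (suc (suc k)) → Tight (columnWord C (suc k)) x
      tight x∈ with dominated k x∈
      ... | y , y∈ , x≤y =
        All.lookup tightC (subst (_ ∈_) (sym C≡interval)
          (∈-interval⁺ (All.lookup (positive (suc k)) x∈)
                       (ℕP.≤-trans x≤y (proj₂ (∈-interval⁻ (subst (y ∈_) C≡interval y∈))))))

  lattice-columns-interval : ∀ c → c < w → C (suc c) ≡ interval 0 (length (C (suc c)))
  lattice-columns-interval c c<w = proj₁ (columns-tight c c<w)

nth-just⇒< : ∀ {A : Set} (xs : List A) k {b} → nth xs k ≡ just b → k < length xs
nth-just⇒< (x ∷ xs) zero    _  = s≤s z≤n
nth-just⇒< (x ∷ xs) (suc k) eq = s≤s (nth-just⇒< xs k eq)

nth-nothing⇒≥ : ∀ {A : Set} (xs : List A) k → nth xs k ≡ nothing → length xs ≤ k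
nth-nothing⇒≥ []       k       _  = z≤n
nth-nothing⇒≥ (x ∷ xs) (suc k) eq = s≤s (nth-nothing⇒≥ xs k eq)

nth-≥length : ∀ {A : Set} (xs : List A) k → length xs ≤ k → nth xs k ≡ nothing
nth-≥length []       k       _       = refl
nth-≥length (x ∷ xs) (suc k) (s≤s p) = nth-≥length xs k p

nth-pred : ∀ {A : Set} (xs : List A) k {b} → nth xs (suc k) ≡ just b → ∃[ a ] (nth xs k ≡ just a)
nth-pred (x ∷ xs)     zero    _  = x , refl
nth-pred (x ∷ y ∷ xs) (suc k) eq = nth-pred (y ∷ xs) k eq

∈-column⁻ : ∀ T c {x} → x ∈ column T (suc c) → ∃[ r ] (at T (suc r) (suc c) ≡ just x)
∈-column⁻ (row ∷ T) c x∈ with nth row c in eq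
... | nothing = let r , p = ∈-column⁻ T c x∈ in suc r , p
... | just _ with x∈
...   | here refl = 0 , eq
...   | there x∈′ = let r , p = ∈-column⁻ T c x∈′ in suc r , p

∈-column⁺ : ∀ T r c {x} → at T (suc r) (suc c) ≡ just x → x ∈ column T (suc c)
∈-column⁺ (row ∷ T) zero    c eq rewrite eq = here refl
∈-column⁺ (row ∷ T) (suc r) c eq with nth row c
... | just _  = there (∈-column⁺ T r c eq)
... | nothing = ∈-column⁺ T r c eq

ColumnsDistinct : Tableau → Set
ColumnsDistinct T = ∀ i k c x y → ¬ (i ≡ k) → at T i c ≡ just x → at T k c ≡ just y → ¬ (x ≡ y)

columnsDistinct-tail : ∀ row T → ColumnsDistinct (row ∷ T) → ColumnsDistinct T
columnsDistinct-tail row T distinct zero    k       c       x y _   ()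
columnsDistinct-tail row T distinct (suc i) zero    c       x y _   _  ()
columnsDistinct-tail row T distinct (suc i) (suc k) zero    x y _   ()
columnsDistinct-tail row T distinct (suc i) (suc k) (suc c) x y i≢k =
  distinct (2 + i) (2 + k) (suc c) x y (i≢k ∘ ℕP.suc-injective)

column-unique : ∀ T c → ColumnsDistinct T → Unique (column T (suc c))
column-unique []        c distinct = []
column-unique (row ∷ T) c distinct with nth row c in eq
... | just x  =
  All.tabulate (λ y∈ → let r , p = ∈-column⁻ T c y∈ in distinct 1 (2 + r) (suc c) x _ (λ ()) eq p)
  ∷ column-unique T c (columnsDistinct-tail row T distinct)
... | nothing = column-unique T c (columnsDistinct-tail row T distinct)

column-positive : ∀ T c → (∀ r c x → at T r c ≡ just x → 1 ≤ x) → All (1 ≤_) (column T (suc c))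
column-positive T c positive = All.tabulate λ x∈ → let r , p = ∈-column⁻ T c x∈ in positive (suc r) (suc c) _ p

column-dominated : ∀ T c → (∀ r c x y → at T r c ≡ just x → at T r (suc c) ≡ just y → y ≤ x) →
  ∀ {x} → x ∈ column T (suc (suc c)) → ∃[ y ] (y ∈ column T (suc c) × x ≤ y)
column-dominated T c rowsDecr {x} x∈ with ∈-column⁻ T (suc c) x∈
... | r , atx with nth T r in eqr
...   | just row with nth-pred row c atx
...     | y , aty = y , ∈-column⁺ T r c aty′ , rowsDecr (suc r) (suc c) y x aty′ atx′
  where
  aty′ : at T (suc r) (suc c) ≡ just y
  aty′ rewrite eqr = aty
  atx′ : at T (suc r) (suc (suc c)) ≡ just x
  atx′ rewrite eqr = atx
column-dominated T c rowsDecr x∈ | r , () | nothing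

length-column : ∀ T c → length (column T (suc c)) ≡ transposeAt (shape T) (suc c)
length-column []        c = refl
length-column (row ∷ T) c with nth row c in eq
... | just x  rewrite LP.filter-accept (suc c ≤?_) {xs = shape T} (nth-just⇒< row c eq) =
  cong suc (length-column T c)
... | nothing rewrite LP.filter-reject (suc c ≤?_) {xs = shape T} (ℕP.≤⇒≯ (nth-nothing⇒≥ row c eq)) =
  length-column T c

column-beyond-width : ∀ T c → maxWidth T ≤ c → column T (suc c) ≡ []
column-beyond-width []        c _ = refl
column-beyond-width (row ∷ T) c width≤c
  rewrite nth-≥length row c (ℕP.≤-trans (ℕP.m≤m⊔n (length row) (maxWidth T)) width≤c) =
  column-beyond-width T c (ℕP.≤-trans (ℕP.m≤n⊔m (length row) (maxWidth T)) width≤c)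

IntervalColumns : Tableau → Set
IntervalColumns T = ∀ c → column T (suc c) ≡ interval 0 (length (column T (suc c)))

column-take-suc : ∀ T r c {x} → at T (suc r) (suc c) ≡ just x →
  column (take (suc r) T) (suc c) ≡ column (take r T) (suc c) ∷ʳ x
column-take-suc (row ∷ T) zero    c eq rewrite eq = refl
column-take-suc (row ∷ T) (suc r) c eq with nth row c
... | just y  = cong (y ∷_) (column-take-suc T r c eq)
... | nothing = column-take-suc T r c eq

length-column-take-suc : ∀ T r c {x} → at T (suc r) (suc c) ≡ just x →
  length (column (take (suc r) T) (suc c)) ≡ suc (length (column (take r T) (suc c)))
length-column-take-suc T r c eq =
  trans (cong length (column-take-suc T r c eq))
        (trans (LP.length-++ (column (take r T) (suc c))) (ℕP.+-comm _ 1))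

column-take-drop : ∀ T n c → column T c ≡ column (take n T) c ++ column (drop n T) c
column-take-drop T n c =
  trans (cong (λ U → column U c) (sym (LP.take++drop≡id n T)))
        (LP.mapMaybe-++ (λ row → nth row (c ∸ 1)) (take n T) (drop n T))

intervalColumns-entry : ∀ T → IntervalColumns T → ∀ r c {x} → at T (suc r) (suc c) ≡ just x →
  x ≡ suc (length (column (take r T) (suc c)))
intervalColumns-entry T intervals r c {x} eq =
  interval-entry 0 _ (column (take r T) (suc c)) x (column (drop (suc r) T) (suc c))
    (trans (sym (intervals c))
      (trans (column-take-drop T (suc r) (suc c))
        (trans (cong (_++ column (drop (suc r) T) (suc c)) (column-take-suc T r c eq))
               (LP.++-assoc (column (take r T) (suc c)) [ x ] _))))

length-column-take-mono : ∀ T {m n} c → m ≤ n →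
  length (column (take m T) (suc c)) ≤ length (column (take n T) (suc c))
length-column-take-mono []        {m} {n} c _ rewrite LP.take-[] {A = List ℕ} m | LP.take-[] {A = List ℕ} n = z≤n
length-column-take-mono (row ∷ T) {zero}          c _       = z≤n
length-column-take-mono (row ∷ T) {suc m} {suc n} c (s≤s m≤n) with nth row c
... | just _  = s≤s (length-column-take-mono T c m≤n)
... | nothing = length-column-take-mono T c m≤n

length-column-suc≤ : ∀ T c → length (column T (suc (suc c))) ≤ length (column T (suc c))
length-column-suc≤ []        c = z≤n
length-column-suc≤ (row ∷ T) c with nth row (suc c) in eq
... | just _ with nth-pred row c eq
...   | _ , eq′ rewrite eq′ = s≤s (length-column-suc≤ T c)
length-column-suc≤ (row ∷ T) c | nothing with nth row c
... | just _  = ℕP.m≤n⇒m≤1+n (length-column-suc≤ T c)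
... | nothing = length-column-suc≤ T c

intervalColumns-increasing : ∀ T → IntervalColumns T → ∀ i k c {x y} → i < k →
  at T i c ≡ just x → at T k c ≡ just y → x < y
intervalColumns-increasing T intervals (suc i) (suc k) (suc c) {x} {y} (s≤s i<k) atx aty =
  subst₂ _<_ (sym (intervalColumns-entry T intervals i c atx)) (sym (intervalColumns-entry T intervals k c aty))
    (s≤s (subst (_≤ length (column (take k T) (suc c))) (length-column-take-suc T i c atx)
                (length-column-take-mono T c i<k)))

intervalColumns⇒key : ∀ T → IntervalColumns T → IsKeyTableau T
intervalColumns⇒key T intervals = record
  { positive     = positive
  ; rowsDecr     = rowsDecr
  ; colsDistinct = colsDistinct
  ; keyCond      = λ i k j x y i<k atx aty y<x →
                     ⊥-elim (ℕP.<-asym y<x (intervalColumns-increasing T intervals i k j i<k atx aty))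
  }
  where
  positive : ∀ r c x → at T r c ≡ just x → 1 ≤ x
  positive (suc r) (suc c) x eq rewrite intervalColumns-entry T intervals r c eq = s≤s z≤n
  rowsDecr : ∀ r c x y → at T r c ≡ just x → at T r (suc c) ≡ just y → y ≤ x
  rowsDecr (suc r) (suc c) x y atx aty
    rewrite intervalColumns-entry T intervals r c atx | intervalColumns-entry T intervals r (suc c) aty =
    s≤s (length-column-suc≤ (take r T) c)
  colsDistinct : ∀ i k c x y → ¬ (i ≡ k) → at T i c ≡ just x → at T k c ≡ just y → ¬ (x ≡ y)
  colsDistinct i k c x y i≢k atx aty x≡y with ℕP.<-cmp i k
  ... | tri< i<k _ _ = ℕP.<-irrefl x≡y (intervalColumns-increasing T intervals i k c i<k atx aty)
  ... | tri≈ _ i≡k _ = i≢k i≡k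
  ... | tri> _ _ k<i = ℕP.<-irrefl (sym x≡y) (intervalColumns-increasing T intervals k i c k<i aty atx)

intervalColumns⇒flagged : ∀ T → IntervalColumns T → ∀ φ → IsFlag φ → Flagged φ T
intervalColumns⇒flagged T intervals φ (_ , φ≥id) (suc r) (suc c) x eq
  rewrite intervalColumns-entry T intervals r c eq =
  ℕP.≤-trans (s≤s (ℕP.≤-trans (LP.length-mapMaybe (λ row → nth row c) (take r T))
                             (subst (_≤ r) (sym (LP.length-take r T)) (ℕP.m⊓n≤m r (length T)))))
             (φ≥id (suc r) (s≤s z≤n))

addRow : ℕ → (ℕ → ℕ) → ℕ → ℕ
addRow a h j with j <? a
... | yes _ = suc (h j)
... | no  _ = h j

addRow-< : ∀ a h {j} → j < a → addRow a h j ≡ suc (h j)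
addRow-< a h {j} j<a with j <? a
... | yes _   = refl
... | no  j≮a = ⊥-elim (j≮a j<a)

addRow-≮ : ∀ a h {j} → ¬ (j < a) → addRow a h j ≡ h j
addRow-≮ a h {j} j≮a with j <? a
... | yes j<a = ⊥-elim (j≮a j<a)
... | no  _   = refl

-- The rows of α placed on top of columns of heights h 0, h 1, … .
stack : (ℕ → ℕ) → WeakComposition → Tableau
stack h []      = []
stack h (a ∷ α) = applyUpTo (λ j → suc (h j)) a ∷ stack (addRow a h) α

shape-stack : ∀ h α → shape (stack h α) ≡ α
shape-stack h []      = refl
shape-stack h (a ∷ α) = cong₂ _∷_ (LP.length-applyUpTo _ a) (shape-stack (addRow a h) α)

nth-applyUpTo-< : ∀ (f : ℕ → ℕ) a c → c < a → nth (applyUpTo f a) c ≡ just (f c)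
nth-applyUpTo-< f (suc a) zero    _       = refl
nth-applyUpTo-< f (suc a) (suc c) (s≤s p) = nth-applyUpTo-< (f ∘ suc) a c p

nth-applyUpTo-≥ : ∀ (f : ℕ → ℕ) a c → a ≤ c → nth (applyUpTo f a) c ≡ nothing
nth-applyUpTo-≥ f zero    c       _       = refl
nth-applyUpTo-≥ f (suc a) (suc c) (s≤s p) = nth-applyUpTo-≥ (f ∘ suc) a c p

column-stack : ∀ h α c → column (stack h α) (suc c) ≡ interval (h c) (transposeAt α (suc c))
column-stack h []      c = refl
column-stack h (a ∷ α) c with c <? a
... | yes c<a
  rewrite nth-applyUpTo-< (λ j → suc (h j)) a c c<a | LP.filter-accept (suc c ≤?_) {xs = α} c<a =
  cong (suc (h c) ∷_) (trans (column-stack (addRow a h) α c)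
                             (cong (λ s → interval s (transposeAt α (suc c))) (addRow-< a h c<a)))
... | no c≮a
  rewrite nth-applyUpTo-≥ (λ j → suc (h j)) a c (ℕP.≮⇒≥ c≮a) | LP.filter-reject (suc c ≤?_) {xs = α} c≮a =
  trans (column-stack (addRow a h) α c) (cong (λ s → interval s (transposeAt α (suc c))) (addRow-≮ a h c≮a))

canonical : WeakComposition → Tableau
canonical = stack (λ _ → 0)

intervalColumns-canonical : ∀ α → IntervalColumns (canonical α)
intervalColumns-canonical α c
  rewrite column-stack (λ _ → 0) α c | length-interval 0 (transposeAt α (suc c)) = refl

transposeAt-positive : ∀ α c → transposeAt (filter (1 ≤?_) α) (suc c) ≡ transposeAt α (suc c)
transposeAt-positive []      c = refl
transposeAt-positive (a ∷ α) c with 1 ≤? a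
... | no a≱1
  rewrite LP.filter-reject (1 ≤?_) {xs = α} a≱1
        | LP.filter-reject (suc c ≤?_) {xs = α} (a≱1 ∘ ℕP.≤-trans (s≤s z≤n)) = transposeAt-positive α c
... | yes a≥1 rewrite LP.filter-accept (1 ≤?_) {xs = α} a≥1 with suc c ≤? a
...   | yes a>c
  rewrite LP.filter-accept (suc c ≤?_) {xs = filter (1 ≤?_) α} a>c
        | LP.filter-accept (suc c ≤?_) {xs = α} a>c = cong suc (transposeAt-positive α c)
...   | no a≯c
  rewrite LP.filter-reject (suc c ≤?_) {xs = filter (1 ≤?_) α} a≯c
        | LP.filter-reject (suc c ≤?_) {xs = α} a≯c = transposeAt-positive α c

transposeAt-↭ : ∀ {α β} c → α ↭ β → transposeAt α c ≡ transposeAt β c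
transposeAt-↭ c α↭β = ↭P.↭-length (↭P.filter-↭ (c ≤?_) α↭β)

transposeAt-partitionOf : ∀ α c → transposeAt (partitionOf α) (suc c) ≡ transposeAt α (suc c)
transposeAt-partitionOf α c =
  trans (transposeAt-↭ (suc c) (↭-trans (↭P.↭-reverse _) (sort-↭ (filter (1 ≤?_) α))))
        (transposeAt-positive α c)

nth-extensionality : ∀ {A : Set} (xs ys : List A) → (∀ k → nth xs k ≡ nth ys k) → xs ≡ ys
nth-extensionality []       []       _    = refl
nth-extensionality []       (y ∷ ys) nth≡ with () ← nth≡ 0
nth-extensionality (x ∷ xs) []       nth≡ with () ← nth≡ 0
nth-extensionality (x ∷ xs) (y ∷ ys) nth≡ with refl ← nth≡ 0 =
  cong (x ∷_) (nth-extensionality xs ys (nth≡ ∘ suc))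

tableau-extensionality : ∀ T U → shape T ≡ shape U → (∀ c → column T (suc c) ≡ column U (suc c)) → T ≡ U
tableau-extensionality []        []        _      _    = refl
tableau-extensionality (r ∷ T) (s ∷ U) shape≡ column≡ =
  cong₂ _∷_ (nth-extensionality r s (proj₁ ∘ split))
            (tableau-extensionality T U (proj₂ (LP.∷-injective shape≡)) (proj₂ ∘ split))
  where
  |r|≡|s| : length r ≡ length s
  |r|≡|s| = proj₁ (LP.∷-injective shape≡)
  split : ∀ c → nth r c ≡ nth s c × column T (suc c) ≡ column U (suc c)
  split c with nth r c in eqr | nth s c in eqs | column≡ c
  ... | just x  | just y  | eq with refl , eq′ ← LP.∷-injective eq = refl , eq′
  ... | nothing | nothing | eq = refl , eq
  ... | just x  | nothing | _ =
    ⊥-elim (ℕP.<⇒≱ (nth-just⇒< r c eqr) (subst (_≤ c) (sym |r|≡|s|) (nth-nothing⇒≥ s c eqs)))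
  ... | nothing | just y  | _ =
    ⊥-elim (ℕP.<⇒≱ (nth-just⇒< s c eqs) (subst (_≤ c) |r|≡|s| (nth-nothing⇒≥ r c eqr)))

highest-weight-columns : ∀ α φ T → SSKT α φ T → (∀ i → 1 ≤ i → e i T ≡ nothing) →
  ∀ c → column T (suc c) ≡ interval 0 (transposeAt α (suc c))
highest-weight-columns α φ T (shape≡ , key , _) e≡nothing c =
  trans column-interval
        (cong (interval 0) (trans (length-column T c) (cong (λ β → transposeAt β (suc c)) shape≡)))
  where
  open IsKeyTableau key
  column-interval : column T (suc c) ≡ interval 0 (length (column T (suc c)))
  column-interval with suc c ≤? maxWidth T
  ... | yes c<width =
    lattice-columns-interval (column T) (maxWidth T)
      (λ d → column-positive T d positive) (λ d → column-unique T d colsDistinct)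
      (λ d → column-dominated T d rowsDecr)
      (λ i 1≤i → subst (Lattice i) (col≡columnWord T) (e≡nothing⇒lattice i T (e≡nothing i 1≤i)))
      c c<width
  ... | no c≮width rewrite column-beyond-width T c (ℕP.≮⇒≥ c≮width) = refl

column-canonical : ∀ α c → column (canonical α) (suc c) ≡ interval 0 (transposeAt α (suc c))
column-canonical = column-stack (λ _ → 0)

canonical-sskt : ∀ α φ → IsFlag φ → SSKT α φ (canonical α)
canonical-sskt α φ flag =
  shape-stack (λ _ → 0) α ,
  intervalColumns⇒key (canonical α) (intervalColumns-canonical α) ,
  intervalColumns⇒flagged (canonical α) (intervalColumns-canonical α) φ flag

canonical-isCanonical : ∀ α → IsCanonical α (canonical α)
canonical-isCanonical α = shape-stack (λ _ → 0) α , columns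
  where
  columns : ∀ c → 1 ≤ c → column (canonical α) c ≡ applyUpTo suc (transposeAt (partitionOf α) c)
  columns (suc c) _ = begin
    column (canonical α) (suc c)
      ≡⟨ column-canonical α c ⟩
    interval 0 (transposeAt α (suc c))
      ≡⟨ sym (applyUpTo≡interval _ 0 suc (λ _ → refl)) ⟩
    applyUpTo suc (transposeAt α (suc c))
      ≡⟨ cong (applyUpTo suc) (sym (transposeAt-partitionOf α c)) ⟩
    applyUpTo suc (transposeAt (partitionOf α) (suc c)) ∎
    where open ≡-Reasoning

canonical-highest-weight : ∀ α i → 1 ≤ i → e i (canonical α) ≡ nothing
canonical-highest-weight α i 1≤i =
  lattice⇒e≡nothing i (canonical α)
    (subst (Lattice i) (sym (col≡columnWord (canonical α)))
      (lattice-columnWord (column (canonical α)) (intervalColumns-canonical α) (maxWidth (canonical α)) 1≤i))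

highest-weight-unique : ∀ α φ T → SSKT α φ T → (∀ i → 1 ≤ i → e i T ≡ nothing) → T ≡ canonical α
highest-weight-unique α φ T sskt e≡nothing =
  tableau-extensionality T (canonical α) (trans (proj₁ sskt) (sym (shape-stack (λ _ → 0) α)))
    (λ c → trans (highest-weight-columns α φ T sskt e≡nothing c) (sym (column-canonical α c)))

proposition4p10 : (α : WeakComposition) (φ : ℕ → ℕ) → IsFlag φ →
    ∃[ T ] ((SSKT α φ T × (∀ i → 1 ≤ i → e i T ≡ nothing) × IsCanonical α T)
      × (∀ T′ → SSKT α φ T′ → (∀ i → 1 ≤ i → e i T′ ≡ nothing) → T′ ≡ T))
proposition4p10 α φ flag =
  canonical α ,
  (canonical-sskt α φ flag , canonical-highest-weight α , canonical-isCanonical α) ,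
  λ T sskt e≡nothing → highest-weight-unique α φ T sskt e≡nothing
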